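{- Let $d\geq 3$, let $G$ be a $d$-regular graph, $v$ a vertex of $G$, and $C$ the vertex set of the component of $G$ containing $v$, with $|C|>2(d+1)$; layer $G$ from $v$ and let $\ell=|V_2|$. Suppose that $1\leq \ell\leq d-1$, $|V_3|\geq 2$, $G[V_2]$ is complete and $V_4=\emptyset$. If some $u\in V_2$ has $\mathrm{id}(u)\geq 2$, then there is a $\Delta^+$-switch transforming $G$ into a graph $G'$ such that ${\rm N}_{G'}(v)={\rm N}_G(v)$, the edges of $G[V_1]$ are unaltered, $u$ has exactly $\mathrm{id}(u)-1$ neighbours in $V_1$ in $G'$, and some vertex of $V_3$ becomes adjacent in $G'$ to a vertex of $V_1$ (thus moving from distance $3$ to distance $2$ from $v$).
   Context: All graphs are simple. Layering from $v$: for $i\ge0$, $V_i$ is the set of vertices of $C$ at distance exactly $i$ from $v$ (so $V_1={\rm N}(v)$). For $u\in V_i$, $\mathrm{id}(u)=|{\rm N}(u)\cap V_{i-1}|$. A $\Delta^+$-switch: if $p,x,y,w,z$ are distinct vertices with $yx, xp, pw, wz\in E$ and $xw, yz\notin E$, delete $xy$, $wz$ and insert $xw$, $yz$. -}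

module Defs where

open import Data.Nat using (ℕ; zero; suc)
open import Data.Fin using (Fin)
open import Data.Bool using (Bool; T)
open import Data.List using (List; length)
open import Data.List.Membership.Propositional using (_∈_)
open import Data.List.Relation.Unary.Unique.Propositional using (Unique)
open import Data.Product using (Σ; _×_; ∃)
open import Data.Sum using (_⊎_)
open import Relation.Nullary using (¬_)
open import Relation.Binary.PropositionalEquality using (_≡_)
open import Function.Bundles using (_⇔_)

record Graph (n : ℕ) : Set where
  field
    adj   : Fin n → Fin n → Bool
    sym   : ∀ a b → adj a b ≡ adj b a
    irrefl : ∀ a → ¬ T (adj a a)
open Graph public

E : ∀ {n} → Graph n → Fin n → Fin n → Set
E G a b = T (adj G a b)

HasSize : ∀ {n} → (Fin n → Set) → ℕ → Set
HasSize {n} P k = Σ (List (Fin n)) λ L → Unique L × (∀ x → (x ∈ L) ⇔ P x) × length L ≡ k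

data Walk {n} (G : Graph n) : Fin n → Fin n → ℕ → Set where
  here : ∀ {a} → Walk G a a zero
  step : ∀ {a b c k} → E G a b → Walk G b c k → Walk G a c (suc k)

AtDist : ∀ {n} → Graph n → Fin n → ℕ → Fin n → Set
AtDist G v i u = Walk G v u i × (∀ j → j Data.Nat.< i → ¬ Walk G v u j)
  where import Data.Nat

InComp : ∀ {n} → Graph n → Fin n → Fin n → Set
InComp G v u = ∃ λ i → Walk G v u i

Regular : ∀ {n} → Graph n → ℕ → Set
Regular G d = ∀ u → HasSize (E G u) d

SamePair : ∀ {n} → Fin n → Fin n → Fin n → Fin n → Set
SamePair a b x y = (a ≡ x × b ≡ y) ⊎ (a ≡ y × b ≡ x)

Distinct5 : ∀ {n} → Fin n → Fin n → Fin n → Fin n → Fin n → Set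
Distinct5 p x y w z =
  ¬ p ≡ x × ¬ p ≡ y × ¬ p ≡ w × ¬ p ≡ z ×
  ¬ x ≡ y × ¬ x ≡ w × ¬ x ≡ z ×
  ¬ y ≡ w × ¬ y ≡ z × ¬ w ≡ z

SwitchOK : ∀ {n} → Graph n → Fin n → Fin n → Fin n → Fin n → Fin n → Set
SwitchOK G p x y w z =
  Distinct5 p x y w z × E G y x × E G x p × E G p w × E G w z ×
  ¬ E G x w × ¬ E G y z

SwAdj : ∀ {n} → Graph n → Fin n → Fin n → Fin n → Fin n → Fin n → Fin n → Set
SwAdj G x y w z a b =
  (E G a b × ¬ SamePair a b x y × ¬ SamePair a b w z)
  ⊎ SamePair a b x w ⊎ SamePair a b y z

-- Choose y ∈ N(u) ∩ V₁. Since V₄ = ∅ we have |C| ≤ 1 + d + ℓ + |V₃|, so |C| > 2(d + 1) gives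
-- ℓ + |V₃| ≥ d + 2; if u were adjacent to all of V₃ it would have at least
-- |V₃| + id(u) + (ℓ − 1) ≥ d + 3 neighbours. Hence some w ∈ V₃ is not adjacent to u; its parent
-- p ∈ V₂ is adjacent to u because G[V₂] is complete. The neighbours of w lie in V₂ ∪ V₃ and
-- |V₂| = ℓ < d, so w has a neighbour z ∈ V₃. The Δ⁺-switch on (p, u, y, w, z) deletes uy, wz and
-- inserts uw, yz: it touches no edge at v or inside V₁, removes exactly one V₁-neighbour of u, and
-- joins z ∈ V₃ to y ∈ V₁.
module Submission where

open import Defs
open import Data.Nat using (ℕ; zero; suc; _≤_; _<_; _*_; _+_; _∸_; z≤n; s≤s; _≤?_)
open import Data.Nat.Properties
open import Data.Nat.Induction using (<-rec)
open import Data.Nat.Tactic.RingSolver using (solve-∀)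
open import Data.Fin using (Fin; toℕ; fromℕ<)
open import Data.Fin.Properties using (toℕ<n; toℕ-fromℕ<) renaming (_≟_ to _≟ᶠ_; any? to anyᶠ?)
open import Data.Bool using (T)
open import Data.Empty using (⊥-elim)
open import Data.Sum as Sum using (_⊎_; inj₁; inj₂)
open import Data.Product using (_×_; ∃; ∃-syntax; _,_; proj₁; proj₂)
open import Data.List using (List; []; _∷_; length; _++_)
open import Data.List.Properties using (length-++)
open import Data.List.Membership.Propositional using (_∈_; find)
open import Data.List.Membership.Propositional.Properties using (∈-++⁺ˡ; ∈-++⁺ʳ; ∈-++⁻)
import Data.List.Membership.DecPropositional as DecMembership
open import Data.List.Relation.Binary.Subset.Propositional using (_⊆_)
open import Data.List.Relation.Unary.Any as Any using (here; there)
open import Data.List.Relation.Unary.All as All using (All)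
open import Data.List.Relation.Unary.All.Properties using (¬All⇒Any¬)
open import Data.List.Relation.Unary.AllPairs using ([]; _∷_)
open import Data.List.Relation.Unary.Unique.Propositional using (Unique)
open import Data.List.Relation.Unary.Unique.Propositional.Properties using (++⁺)
open import Relation.Nullary using (¬_; Dec; yes; no)
import Relation.Nullary.Decidable as Dec
open import Relation.Binary.Definitions using (tri<; tri≈; tri>)
open import Relation.Nullary.Decidable using (T?; _×-dec_)
open import Relation.Unary using (Decidable)
open import Relation.Binary.PropositionalEquality as ≡ using (_≡_; _≢_; refl; cong; subst)
open import Function.Bundles using (_⇔_; mk⇔; Equivalence)
open import Function.Properties.Equivalence using () renaming (sym to ⇔-sym; trans to ⇔-trans)
open import Function.Base using (_∘_; id)
open Equivalence using (to; from)

∈-remove : ∀ {A : Set} {x : A} (ys : List A) → x ∈ ys →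
  ∃ λ zs → length ys ≡ suc (length zs) × (∀ {a} → a ∈ ys → a ≢ x → a ∈ zs)
∈-remove (y ∷ ys) (here refl) = ys , refl , λ { (here refl) a≢x → ⊥-elim (a≢x refl) ; (there a∈) _ → a∈ }
∈-remove (y ∷ ys) (there x∈ys) with zs , len , keep ← ∈-remove ys x∈ys =
  y ∷ zs , cong suc len , λ { (here refl) _ → here refl ; (there a∈) a≢x → there (keep a∈ a≢x) }

Unique-⊆⇒length≤ : ∀ {A : Set} {xs ys : List A} → Unique xs → xs ⊆ ys → length xs ≤ length ys
Unique-⊆⇒length≤ {xs = []} _ _ = z≤n
Unique-⊆⇒length≤ {xs = x ∷ xs} {ys} (x∉xs ∷ uxs) xs⊆ys
  with zs , len , keep ← ∈-remove ys (xs⊆ys (here refl)) =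
  subst (suc (length xs) ≤_) (≡.sym len)
    (s≤s (Unique-⊆⇒length≤ uxs λ a∈xs → keep (xs⊆ys (there a∈xs)) λ a≡x → All.lookup x∉xs a∈xs (≡.sym a≡x)))

module _ {n : ℕ} where

  size-mono : ∀ {P Q : Fin n → Set} {a b} → HasSize P a → HasSize Q b → (∀ x → P x → Q x) → a ≤ b
  size-mono (L , uL , L⇔P , refl) (M , _ , M⇔Q , refl) P⊆Q =
    Unique-⊆⇒length≤ uL λ {x} x∈L → from (M⇔Q x) (P⊆Q x (to (L⇔P x) x∈L))

  size-cong : ∀ {P Q : Fin n → Set} {a} → (∀ x → P x ⇔ Q x) → HasSize P a → HasSize Q a
  size-cong P⇔Q (L , uL , L⇔P , len) = L , uL , (λ x → ⇔-trans (L⇔P x) (P⇔Q x)) , len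

  size-singleton : ∀ {x : Fin n} → HasSize (x ≡_) 1
  size-singleton {x} = x ∷ [] , (All.[] ∷ []) , (λ a → mk⇔ (λ { (here refl) → refl }) (λ { refl → here refl })) , refl

  size-∪ : ∀ {P Q : Fin n → Set} {a b} → HasSize P a → HasSize Q b → (∀ x → P x → ¬ Q x) →
    HasSize (λ x → P x ⊎ Q x) (a + b)
  size-∪ (L , uL , L⇔P , refl) (M , uM , M⇔Q , refl) disjoint =
    L ++ M ,
    ++⁺ uL uM (λ {x} (x∈L , x∈M) → disjoint x (to (L⇔P x) x∈L) (to (M⇔Q x) x∈M)) ,
    (λ x → mk⇔ (λ x∈ → Sum.map (to (L⇔P x)) (to (M⇔Q x)) (∈-++⁻ L x∈))
               Sum.[ (λ px → ∈-++⁺ˡ (from (L⇔P x) px)) , (λ qx → ∈-++⁺ʳ L (from (M⇔Q x) qx)) ]) ,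
    length-++ L

  size-pick : ∀ {P : Fin n → Set} {k} → HasSize P (suc k) → ∃ λ y → P y × HasSize (λ a → P a × a ≢ y) k
  size-pick (y ∷ L , y∉L ∷ uL , L⇔P , len) =
    y , to (L⇔P y) (here refl) ,
    L , uL ,
    (λ a → mk⇔ (λ a∈L → to (L⇔P a) (there a∈L) , λ a≡y → All.lookup y∉L a∈L (≡.sym a≡y))
               (λ (pa , a≢y) → Any.tail (λ a≡y → a≢y a≡y) (from (L⇔P a) pa))) ,
    suc-injective len

  size⇒dec : ∀ {P : Fin n → Set} {a} → HasSize P a → Decidable P
  size⇒dec (L , _ , L⇔P , _) x = Dec.map (L⇔P x) (x ∈? L)
    where open DecMembership (_≟ᶠ_ {n}) using (_∈?_)

  size-all⊎counterexample : ∀ {P Q : Fin n → Set} {a} → HasSize P a → Decidable Q →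
    (∀ x → P x → Q x) ⊎ ∃ λ x → P x × ¬ Q x
  size-all⊎counterexample (L , _ , L⇔P , _) Q? with All.all? Q? L
  ... | yes all = inj₁ λ x px → All.lookup all (from (L⇔P x) px)
  ... | no ¬all with x , x∈L , ¬qx ← find (¬All⇒Any¬ Q? L ¬all) = inj₂ (x , to (L⇔P x) x∈L , ¬qx)

≤-between : ∀ {i j} → i ≤ j → j ≤ 2 + i → j ≡ i ⊎ j ≡ 1 + i ⊎ j ≡ 2 + i
≤-between {j = zero} z≤n _ = inj₁ refl
≤-between {j = suc zero} z≤n _ = inj₂ (inj₁ refl)
≤-between {j = suc (suc zero)} z≤n _ = inj₂ (inj₂ refl)
≤-between {j = suc (suc (suc _))} z≤n (s≤s (s≤s ()))
≤-between (s≤s i≤j) (s≤s j≤) = Sum.map (cong suc) (Sum.map (cong suc) (cong suc)) (≤-between i≤j j≤)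

too-many-vertices : ∀ {d c ℓ m k} → 2 * (d + 1) < c → c ≤ 1 + (d + (ℓ + m)) → 2 ≤ k → ¬ m + (k + ℓ) ≤ 1 + d
too-many-vertices {d} {c} {ℓ} {m} {k} c-large c≤ k≥2 degree≤ = <-irrefl refl (begin-strict
    1 + d            <⟨ s≤s (s≤s (m≤n+m d 2)) ⟩
    2 + (2 + d)      ≤⟨ +-mono-≤ k≥2 ℓ+m-large ⟩
    k + (ℓ + m)      ≡⟨ reorder k ℓ m ⟩
    m + (k + ℓ)      ≤⟨ degree≤ ⟩
    1 + d            ∎)
  where
  open ≤-Reasoning
  double : ∀ d → 2 * (d + 1) ≡ d + (2 + d)
  double = solve-∀
  reorder : ∀ k ℓ m → k + (ℓ + m) ≡ m + (k + ℓ)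
  reorder = solve-∀
  ℓ+m-large : 2 + d ≤ ℓ + m
  ℓ+m-large = +-cancelˡ-≤ d (2 + d) (ℓ + m) (subst (_≤ d + (ℓ + m)) (double d) (≤-pred (<-≤-trans c-large c≤)))

≤∸1⇒< : ∀ {ℓ d} → 1 ≤ d → ℓ ≤ d ∸ 1 → ℓ < d
≤∸1⇒< {d = suc d} _ ℓ≤d = s≤s ℓ≤d

module _ {n : ℕ} (G : Graph n) where

  E-sym : ∀ {a b} → E G a b → E G b a
  E-sym {a} {b} = subst T (sym G a b)

  E⇒≢ : ∀ {a b} → E G a b → a ≢ b
  E⇒≢ {a} e refl = irrefl G a e

  walk? : ∀ a b k → Dec (Walk G a b k)
  walk? a b zero with a ≟ᶠ b
  ... | yes refl = yes here
  ... | no a≢b = no λ { here → a≢b refl }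
  walk? a b (suc k) with anyᶠ? (λ c → T? (adj G a c) ×-dec walk? c b k)
  ... | yes (c , e , w) = yes (step e w)
  ... | no none = no λ { (step e w) → none (_ , e , w) }

module _ {n : ℕ} {G : Graph n} where

  _▷_ : ∀ {a b c i} → Walk G a b i → E G b c → Walk G a c (suc i)
  here ▷ e = step e here
  step e′ w ▷ e = step e′ (w ▷ e)

  _++ʷ_ : ∀ {a b c i j} → Walk G a b i → Walk G b c j → Walk G a c (i + j)
  here ++ʷ w′ = w′
  step e w ++ʷ w′ = step e (w ++ʷ w′)

  splitAt : ∀ {a c} i {j} → Walk G a c (i + j) → ∃ λ b → Walk G a b i × Walk G b c j
  splitAt zero w = _ , here , w
  splitAt (suc i) (step e w) with b , w₁ , w₂ ← splitAt i w = b , step e w₁ , w₂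

module Layers {n : ℕ} (G : Graph n) (v : Fin n) where

  V : ℕ → Fin n → Set
  V = AtDist G v

  V-unique : ∀ {i j a} → V i a → V j a → i ≡ j
  V-unique {i} {j} (wᵢ , minᵢ) (wⱼ , minⱼ) with <-cmp i j
  ... | tri< i<j _ _ = ⊥-elim (minⱼ i i<j wᵢ)
  ... | tri≈ _ i≡j _ = i≡j
  ... | tri> _ _ j<i = ⊥-elim (minᵢ j j<i wⱼ)

  V-≢ : ∀ {i j a b} → i ≢ j → V i a → V j b → a ≢ b
  V-≢ i≢j vᵢ vⱼ refl = i≢j (V-unique vᵢ vⱼ)

  v∈V₀ : V 0 v
  v∈V₀ = here , λ _ ()

  V₁⇔N : ∀ a → V 1 a ⇔ E G v a
  V₁⇔N a = mk⇔ (λ { (step e here , _) → e }) (λ e → step e here , λ { zero (s≤s z≤n) here → irrefl G v e })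

  size-V₀ : HasSize (V 0) 1
  size-V₀ = size-cong (λ a → mk⇔ (λ { refl → v∈V₀ }) λ { (here , _) → refl }) size-singleton

  size-V₁ : ∀ {d} → Regular G d → HasSize (V 1) d
  size-V₁ reg = size-cong (λ a → ⇔-sym (V₁⇔N a)) (reg v)

  V-adjacent≤ : ∀ {i j a b} → V i a → E G a b → V j b → j ≤ suc i
  V-adjacent≤ {i} {j} (wₐ , _) e (_ , min′) with j ≤? suc i
  ... | yes j≤ = j≤
  ... | no j≰ = ⊥-elim (min′ (suc i) (≰⇒> j≰) (wₐ ▷ e))

  shortest : ∀ {a} i → Walk G v a i → ∃ λ j → V j a
  shortest {a} = <-rec _ λ i rec w → shorter-or-minimal i rec w (anyᶠ? λ (j : Fin i) → walk? G v a (toℕ j))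
    where
    shorter-or-minimal : ∀ i → (∀ {j} → j < i → Walk G v a j → ∃ λ j → V j a) → Walk G v a i →
      Dec (∃ λ (j : Fin i) → Walk G v a (toℕ j)) → ∃ λ j → V j a
    shorter-or-minimal i rec w (yes (j , wⱼ)) = rec (toℕ<n j) wⱼ
    shorter-or-minimal i rec w (no none) = i , w , λ j j<i wⱼ →
      none (fromℕ< j<i , subst (Walk G v a) (≡.sym (toℕ-fromℕ< j<i)) wⱼ)

  V-bounded : ∀ {r j a} → (∀ b → ¬ V r b) → V j a → j < r
  V-bounded {r} {j} noᵣ (w , min) with r ≤? j
  ... | no r≰j = ≰⇒> r≰j
  ... | yes r≤j with b , w₁ , w₂ ← splitAt r {j ∸ r} (subst (Walk G v _) (≡.sym (m+[n∸m]≡n r≤j)) w) =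
    ⊥-elim (noᵣ b (w₁ , λ i i<r wᵢ →
      min (i + (j ∸ r)) (subst (i + (j ∸ r) <_) (m+[n∸m]≡n r≤j) (+-monoˡ-< (j ∸ r) i<r)) (wᵢ ++ʷ w₂)))

  V-parent : ∀ {i a} → V (suc i) a → ∃ λ b → V i b × E G b a
  V-parent {i} (w , min) with b , w₁ , step e here ← splitAt i {1} (subst (Walk G v _) (≡.sym (+-comm i 1)) w) =
    b , (w₁ , λ j j<i wⱼ → min (suc j) (s≤s j<i) (wⱼ ▷ e)) , e

  V-neighbour : ∀ {i a b} → V (suc i) a → E G a b → V i b ⊎ V (suc i) b ⊎ V (2 + i) b
  V-neighbour {i} {a} {b} vₐ e with j , vⱼ ← shortest (2 + i) (proj₁ vₐ ▷ e) =
    Sum.map at (Sum.map at at)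
      (≤-between (≤-pred (V-adjacent≤ vⱼ (E-sym G e) vₐ)) (V-adjacent≤ vₐ e vⱼ))
    where
    at : ∀ {k} → j ≡ k → V k b
    at refl = vⱼ

module _ {n : ℕ} {G : Graph n} {v : Fin n} where
  open Layers G v

  layers-disjoint : ∀ {i j} → i ≢ j → ∀ a → V i a → ¬ V j a
  layers-disjoint i≢j a vᵢ vⱼ = V-≢ i≢j vᵢ vⱼ refl

  component⊆V₀₋₃ : (∀ a → ¬ V 4 a) → ∀ a → InComp G v a → V 0 a ⊎ V 1 a ⊎ V 2 a ⊎ V 3 a
  component⊆V₀₋₃ no₄ a (i , w) with shortest i w
  ... | j , vⱼ = layer j (V-bounded no₄ vⱼ) vⱼ
    where
    layer : ∀ j → j < 4 → V j a → V 0 a ⊎ V 1 a ⊎ V 2 a ⊎ V 3 a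
    layer 0 _ = inj₁
    layer 1 _ = inj₂ ∘ inj₁
    layer 2 _ = inj₂ ∘ inj₂ ∘ inj₁
    layer 3 _ = inj₂ ∘ inj₂ ∘ inj₂
    layer (suc (suc (suc (suc _)))) (s≤s (s≤s (s≤s (s≤s ()))))

  component-size≤ : ∀ {d ℓ m c} → Regular G d → HasSize (V 2) ℓ → HasSize (V 3) m → (∀ a → ¬ V 4 a) →
    HasSize (InComp G v) c → c ≤ 1 + (d + (ℓ + m))
  component-size≤ reg s₂ s₃ no₄ sC =
    size-mono sC
      (size-∪ size-V₀
        (size-∪ (size-V₁ reg)
          (size-∪ s₂ s₃ (layers-disjoint λ ()))
          λ a v₁ → Sum.[ layers-disjoint (λ ()) a v₁ , layers-disjoint (λ ()) a v₁ ])
        λ a v₀ → Sum.[ layers-disjoint (λ ()) a v₀ , Sum.[ layers-disjoint (λ ()) a v₀ , layers-disjoint (λ ()) a v₀ ] ])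
      (component⊆V₀₋₃ no₄)

  neighbourhood-size≤ : ∀ {d ℓ m k u} → Regular G d →
    (∀ a b → V 2 a → V 2 b → a ≢ b → E G a b) → V 2 u →
    HasSize (V 2) ℓ → HasSize (V 3) m → HasSize (λ a → E G u a × V 1 a) k →
    (∀ a → V 3 a → E G u a) → m + (k + ℓ) ≤ 1 + d
  neighbourhood-size≤ {u = u} reg complete u₂ s₂ s₃ sₖ u~V₃ =
    size-mono
      (size-∪ s₃ (size-∪ sₖ s₂ λ a (_ , a₁) → layers-disjoint (λ ()) a a₁)
        λ a a₃ → Sum.[ (λ (_ , a₁) → layers-disjoint (λ ()) a a₃ a₁) , layers-disjoint (λ ()) a a₃ ])
      (size-∪ size-singleton (reg u) λ a u≡a e → E⇒≢ G e u≡a)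
      inclusion
    where
    -- u itself lies in V₂, hence the extra 1 on the right.
    inclusion : ∀ a → V 3 a ⊎ (E G u a × V 1 a) ⊎ V 2 a → u ≡ a ⊎ E G u a
    inclusion a (inj₁ a₃) = inj₂ (u~V₃ a a₃)
    inclusion a (inj₂ (inj₁ (e , _))) = inj₂ e
    inclusion a (inj₂ (inj₂ a₂)) with u ≟ᶠ a
    ... | yes u≡a = inj₁ u≡a
    ... | no u≢a = inj₂ (complete u a u₂ a₂ u≢a)

  V₃-neighbour-in-V₃ : ∀ {d ℓ m w} → Regular G d → HasSize (V 2) ℓ → HasSize (V 3) m →
    (∀ a → ¬ V 4 a) → ℓ < d → V 3 w → ∃ λ z → E G w z × V 3 z
  V₃-neighbour-in-V₃ {w = w} reg s₂ s₃ no₄ ℓ<d w₃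
    with size-all⊎counterexample (reg w) (Dec.¬? ∘ size⇒dec s₃)
  ... | inj₂ (z , e , ¬¬z₃) = z , e , Dec.decidable-stable (size⇒dec s₃ z) ¬¬z₃
  ... | inj₁ none = ⊥-elim (<⇒≱ ℓ<d (size-mono (reg w) s₂ λ b e →
        Sum.[ id , Sum.[ (λ b₃ → ⊥-elim (none b e b₃)) , (λ b₄ → ⊥-elim (no₄ b b₄)) ] ] (V-neighbour w₃ e)))

  V₃-vertex-non-adjacent : ∀ {d c ℓ m k u} → Regular G d →
    HasSize (InComp G v) c → 2 * (d + 1) < c → HasSize (V 2) ℓ → HasSize (V 3) m →
    (∀ a b → V 2 a → V 2 b → a ≢ b → E G a b) → (∀ a → ¬ V 4 a) →
    V 2 u → HasSize (λ a → E G u a × V 1 a) k → 2 ≤ k → ∃ λ w → V 3 w × ¬ E G u w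
  V₃-vertex-non-adjacent {ℓ = ℓ} {m} {u = u} reg sC c-large s₂ s₃ complete no₄ u₂ sₖ k≥2
    with size-all⊎counterexample s₃ (λ b → T? (adj G u b))
  ... | inj₂ w = w
  ... | inj₁ u~V₃ = ⊥-elim (too-many-vertices {ℓ = ℓ} {m} c-large (component-size≤ reg s₂ s₃ no₄ sC) k≥2
        (neighbourhood-size≤ reg complete u₂ s₂ s₃ sₖ u~V₃))

module _ {n : ℕ} {a b s t : Fin n} where

  ¬SamePair-left : a ≢ s → a ≢ t → ¬ SamePair a b s t
  ¬SamePair-left a≢s a≢t = Sum.[ a≢s ∘ proj₁ , a≢t ∘ proj₁ ]

  ¬SamePair-fst : a ≢ s → b ≢ s → ¬ SamePair a b s t
  ¬SamePair-fst a≢s b≢s = Sum.[ a≢s ∘ proj₁ , b≢s ∘ proj₂ ]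

  ¬SamePair-snd : a ≢ t → b ≢ t → ¬ SamePair a b s t
  ¬SamePair-snd a≢t b≢t = Sum.[ b≢t ∘ proj₂ , a≢t ∘ proj₁ ]

module _ {n : ℕ} (G : Graph n) {x y w z : Fin n} where

  SwAdj-untouched : ∀ {a b} → ¬ SamePair a b x y → ¬ SamePair a b w z →
    ¬ SamePair a b x w → ¬ SamePair a b y z → SwAdj G x y w z a b ⇔ E G a b
  SwAdj-untouched ¬xy ¬wz ¬xw ¬yz =
    mk⇔ Sum.[ proj₁ , Sum.[ ⊥-elim ∘ ¬xw , ⊥-elim ∘ ¬yz ] ] (λ e → inj₁ (e , ¬xy , ¬wz))

  SwAdj-at-x : x ≢ y → x ≢ w → x ≢ z → ∀ a → SwAdj G x y w z x a ⇔ ((E G x a × a ≢ y) ⊎ a ≡ w)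
  SwAdj-at-x x≢y x≢w x≢z a = mk⇔ to′ from′
    where
    to′ : SwAdj G x y w z x a → (E G x a × a ≢ y) ⊎ a ≡ w
    to′ (inj₁ (e , ¬xy , _)) = inj₁ (e , λ a≡y → ¬xy (inj₁ (refl , a≡y)))
    to′ (inj₂ (inj₁ (inj₁ (_ , a≡w)))) = inj₂ a≡w
    to′ (inj₂ (inj₁ (inj₂ (x≡w , _)))) = ⊥-elim (x≢w x≡w)
    to′ (inj₂ (inj₂ yz)) = ⊥-elim (¬SamePair-left x≢y x≢z yz)
    from′ : (E G x a × a ≢ y) ⊎ a ≡ w → SwAdj G x y w z x a
    from′ (inj₁ (e , a≢y)) = inj₁ (e , Sum.[ a≢y ∘ proj₂ , x≢y ∘ proj₁ ] , ¬SamePair-left x≢w x≢z)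
    from′ (inj₂ a≡w) = inj₂ (inj₁ (inj₁ (refl , a≡w)))

SwitchOutcome : ∀ {n} → Graph n → (v u : Fin n) → ℕ → (p x y w z : Fin n) → Set
SwitchOutcome G v u k p x y w z =
    SwitchOK G p x y w z
  × (∀ a → SwAdj G x y w z v a ⇔ E G v a)
  × (∀ a b → AtDist G v 1 a → AtDist G v 1 b → SwAdj G x y w z a b ⇔ E G a b)
  × HasSize (λ a → SwAdj G x y w z u a × AtDist G v 1 a) k
  × ∃[ s ] ∃[ t ] (AtDist G v 3 s × AtDist G v 1 t × SwAdj G x y w z s t)

module _ {n : ℕ} {G : Graph n} {v : Fin n} where
  open Layers G v

  switch-outcome : ∀ {p u y w z k} → V 2 p → V 2 u → V 1 y → V 3 w → V 3 z →
    E G u y → E G u p → E G p w → E G w z → ¬ E G u w →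
    HasSize (λ a → (E G u a × V 1 a) × a ≢ y) k → SwitchOutcome G v u k p u y w z
  switch-outcome {p} {u} {y} {w} {z} p₂ u₂ y₁ w₃ z₃ uy up pw wz ¬uw sₖ =
      ( ( p≢u , V-≢ (λ ()) p₂ y₁ , V-≢ (λ ()) p₂ w₃ , V-≢ (λ ()) p₂ z₃
        , u≢y , u≢w , u≢z , V-≢ (λ ()) y₁ w₃ , V-≢ (λ ()) y₁ z₃ , E⇒≢ G wz )
      , E-sym G uy , up , pw , wz , ¬uw , (λ yz → <⇒≱ ≤-refl (V-adjacent≤ y₁ yz z₃)) )
    , (λ a → SwAdj-untouched G (¬SamePair-left (v≢ u₂) (v≢ y₁)) (¬SamePair-left (v≢ w₃) (v≢ z₃))
                               (¬SamePair-left (v≢ u₂) (v≢ w₃)) (¬SamePair-left (v≢ y₁) (v≢ z₃)))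
    , (λ a b a₁ b₁ → SwAdj-untouched G (¬SamePair-fst (V-≢ (λ ()) a₁ u₂) (V-≢ (λ ()) b₁ u₂))
                                       (¬SamePair-snd (V-≢ (λ ()) a₁ z₃) (V-≢ (λ ()) b₁ z₃))
                                       (¬SamePair-fst (V-≢ (λ ()) a₁ u₂) (V-≢ (λ ()) b₁ u₂))
                                       (¬SamePair-snd (V-≢ (λ ()) a₁ z₃) (V-≢ (λ ()) b₁ z₃)))
    , size-cong inner sₖ
    , z , y , z₃ , y₁ , inj₂ (inj₂ (inj₂ (refl , refl)))
    where
    p≢u : p ≢ u
    p≢u refl = ¬uw pw
    u≢y : u ≢ y
    u≢y = V-≢ (λ ()) u₂ y₁
    u≢w : u ≢ w
    u≢w = V-≢ (λ ()) u₂ w₃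
    u≢z : u ≢ z
    u≢z = V-≢ (λ ()) u₂ z₃
    v≢ : ∀ {i a} → V (suc i) a → v ≢ a
    v≢ = V-≢ (λ ()) v∈V₀
    inner : ∀ a → ((E G u a × V 1 a) × a ≢ y) ⇔ (SwAdj G u y w z u a × V 1 a)
    inner a = mk⇔ (λ ((e , a₁) , a≢y) → from (SwAdj-at-x G u≢y u≢w u≢z a) (inj₁ (e , a≢y)) , a₁)
      λ (s , a₁) → Sum.[ (λ (e , a≢y) → (e , a₁) , a≢y) , (λ a≡w → ⊥-elim (V-≢ (λ ()) a₁ w₃ a≡w)) ]
                     (to (SwAdj-at-x G u≢y u≢w u≢z a) s)

lemma3p7 : ∀ {n} (d : ℕ) (G : Graph n) (v : Fin n) →
    3 ≤ d → Regular G d →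
    (c : ℕ) → HasSize (InComp G v) c → 2 * (d + 1) < c →
    (ℓ : ℕ) → HasSize (AtDist G v 2) ℓ → 1 ≤ ℓ → ℓ ≤ d ∸ 1 →
    (m : ℕ) → HasSize (AtDist G v 3) m → 2 ≤ m →
    (∀ a b → AtDist G v 2 a → AtDist G v 2 b → ¬ a ≡ b → E G a b) →
    (∀ a → ¬ AtDist G v 4 a) →
    (u : Fin n) → AtDist G v 2 u →
    (k : ℕ) → HasSize (λ w → E G u w × AtDist G v 1 w) k → 2 ≤ k →
    ∃[ p ] ∃[ x ] ∃[ y ] ∃[ w ] ∃[ z ]
      ( SwitchOK G p x y w z
      × (∀ a → SwAdj G x y w z v a ⇔ E G v a)
      × (∀ a b → AtDist G v 1 a → AtDist G v 1 b → SwAdj G x y w z a b ⇔ E G a b)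
      × HasSize (λ a → SwAdj G x y w z u a × AtDist G v 1 a) (k ∸ 1)
      × ∃[ s ] ∃[ t ] (AtDist G v 3 s × AtDist G v 1 t × SwAdj G x y w z s t) )
lemma3p7 d G v d≥3 reg c sC c-large ℓ s₂ _ ℓ≤d∸1 m s₃ _ complete no₄ u u₂ k sₖ k≥2@(s≤s (s≤s _))
  with y , (uy , y₁) , sₖ₋₁ ← size-pick sₖ
  with w , w₃ , ¬uw ← V₃-vertex-non-adjacent reg sC c-large s₂ s₃ complete no₄ u₂ sₖ k≥2
  with p , p₂ , pw ← Layers.V-parent G v w₃
  with z , wz , z₃ ← V₃-neighbour-in-V₃ reg s₂ s₃ no₄ (≤∸1⇒< (≤-trans (s≤s z≤n) d≥3) ℓ≤d∸1) w₃ =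
  p , u , y , w , z ,
  switch-outcome p₂ u₂ y₁ w₃ z₃ uy (complete u p u₂ p₂ λ { refl → ¬uw pw }) pw wz ¬uw sₖ₋₁
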